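{- Let $AB$ be an edge of a pendant tree $T$ of a graph $G$, and let $a_{max}$ be a vertex in $A$ of maximum degree (in $G$) among the vertices of $A$. Then $c(AB)<d_G(a_{max})$.
   Context: Graphs are finite, undirected (parallel edges allowed). For $X\subseteq V$, $d_G(X)$ is the number of edges with exactly one endpoint in $X$. For vertices $v\neq w$, $\lambda_G(v,w)$ is the minimum of $d_G(X)$ over $X$ containing exactly one of $v,w$. A pair $\{v,w\}$ of distinct vertices is pendant if $\lambda_G(v,w)=\min\{d_G(v),d_G(w)\}$. For a tree $T$ whose vertex set (blocks) is a partition of $V$ and an edge $AB$ of $T$, $C_{AB}$ is the union of blocks in the component of $T-AB$ containing $A$, and $c(AB):=d_G(C_{AB})$. A pendant tree of $G$ is such a tree with: (i) every two distinct vertices in a common block form a pendant pair; (ii) for every edge $AB$ there are $a\in A$, $b\in B$ with $\{a,b\}$ non-pendant; (iii) for every edge $AB$ there are $a^*\in A$, $b^*\in B$ with $c(AB)=\lambda_G(a^*,b^*)$. -}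

module Defs where

open import Data.Nat using (ℕ; zero; suc; _+_; _≤_; _<_; _⊓_; _∸_)
open import Data.Bool using (Bool; true; false; _∧_; _∨_; _xor_; if_then_else_)
open import Data.Fin using (Fin; _≟_)
open import Data.List using (List; []; _∷_; length; lookup; removeAt; allFin)
open import Data.Bool.ListAction using (any)
open import Data.Product using (_×_; _,_; proj₁; proj₂; ∃; ∃-syntax; Σ)
open import Data.Sum using (_⊎_)
open import Relation.Nullary using (¬_)
open import Relation.Nullary.Decidable using (⌊_⌋)
open import Relation.Binary.PropositionalEquality using (_≡_; _≢_)

-- A (multi)graph on vertex set Fin n: a list of edges (parallel edges allowed).
Graph : ℕ → Set
Graph n = List (Fin n × Fin n)

VSet : ℕ → Set
VSet n = Fin n → Bool

d : ∀ {n} → Graph n → VSet n → ℕ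
d [] X = 0
d ((u , v) ∷ E) X = (if X u xor X v then 1 else 0) + d E X

singleton : ∀ {n} → Fin n → VSet n
singleton v x = ⌊ x ≟ v ⌋

deg : ∀ {n} → Graph n → Fin n → ℕ
deg G v = d G (singleton v)

Separates : ∀ {n} → VSet n → Fin n → Fin n → Set
Separates X v w = (X v xor X w) ≡ true

IsLambda : ∀ {n} → Graph n → Fin n → Fin n → ℕ → Set
IsLambda G v w k =
  (∃[ X ] (Separates X v w × d G X ≡ k)) ×
  (∀ (X : VSet n) → Separates X v w → k ≤ d G X)
  where n = _

Pendant : ∀ {n} → Graph n → Fin n → Fin n → Set
Pendant G v w = IsLambda G v w (deg G v ⊓ deg G w)

-- Component of a vertex in a multigraph on Fin m (list of edges),
-- computed as the Boolean closure under adjacency, iterated m times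
-- (every vertex reachable is reachable by a path with ≤ m-1 edges).
adjB : ∀ {m} → List (Fin m × Fin m) → Fin m → Fin m → Bool
adjB E x y = any (λ e → (⌊ proj₁ e ≟ x ⌋ ∧ ⌊ proj₂ e ≟ y ⌋) ∨ (⌊ proj₁ e ≟ y ⌋ ∧ ⌊ proj₂ e ≟ x ⌋)) E

stepB : ∀ {m} → List (Fin m × Fin m) → (Fin m → Bool) → (Fin m → Bool)
stepB {m} E R y = R y ∨ any (λ x → R x ∧ adjB E x y) (allFin m)

iterB : ∀ {m} → List (Fin m × Fin m) → ℕ → (Fin m → Bool) → (Fin m → Bool)
iterB E zero R = R
iterB E (suc k) R = stepB E (iterB E k R)

comp : ∀ {m} → List (Fin m × Fin m) → Fin m → Fin m → Bool
comp {m} E A = iterB E m (λ y → ⌊ y ≟ A ⌋)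

IsTree : (m : ℕ) → List (Fin m × Fin m) → Set
IsTree m ET = (1 ≤ m) × (∀ x y → comp ET x y ≡ true) × (length ET ≡ m ∸ 1)

-- Tree structure whose vertices (blocks) partition V(G) = Fin n:
-- m blocks, block map f (each vertex lies in exactly one block; every
-- block nonempty), and tree edges ET on the blocks.
record BlockTree (n : ℕ) : Set where
  field
    m    : ℕ
    blk  : Fin n → Fin m
    nonempty : ∀ (A : Fin m) → ∃[ v ] (blk v ≡ A)
    ET   : List (Fin m × Fin m)
    tree : IsTree m ET
open BlockTree public

-- C_{AB} for the tree edge with index i, taking A as the side containing A:
-- the union of blocks in the component of T - (edge i) containing A.
C : ∀ {n} (T : BlockTree n) → Fin (length (ET T)) → Fin (m T) → VSet n
C T i A v = comp (removeAt (ET T) i) A (blk T v)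

c : ∀ {n} → Graph n → (T : BlockTree n) → Fin (length (ET T)) → Fin (m T) → ℕ
c G T i A = d G (C T i A)

eA : ∀ {n} (T : BlockTree n) → Fin (length (ET T)) → Fin (m T)
eA T i = proj₁ (lookup (ET T) i)
eB : ∀ {n} (T : BlockTree n) → Fin (length (ET T)) → Fin (m T)
eB T i = proj₂ (lookup (ET T) i)

IsPendantTree : ∀ {n} → Graph n → BlockTree n → Set
IsPendantTree G T =
  -- (i)
  (∀ v w → v ≢ w → blk T v ≡ blk T w → Pendant G v w) ×
  -- (ii)
  (∀ i → ∃[ a ] ∃[ b ] (blk T a ≡ eA T i × blk T b ≡ eB T i × ¬ Pendant G a b)) ×
  -- (iii)
  (∀ i → ∃[ a ] ∃[ b ] (blk T a ≡ eA T i × blk T b ≡ eB T i ×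
            IsLambda G a b (c G T i (eA T i))))

module Submission where

-- Idea.  Property (iii) gives a* ∈ A, b* ∈ B with λ(a*,b*) = c(AB), and (ii)
-- gives a non-pendant pair a ∈ A, b ∈ B.  If d(a_max) ≤ c(AB), then
-- t = min(d(a), d(b)) ≤ d(a) ≤ d(a_max) ≤ c(AB).  A set X separating a from b
-- separates one of the consecutive pairs of the chain a, a*, b*, b; the outer
-- pairs lie in a common block, hence are pendant by (i), and the middle pair
-- has λ = c(AB); in every case d(X) ≥ t, so {a,b} would be pendant.

open import Defs
open import Data.Nat using (ℕ; zero; suc; _≤_; _<_; _+_; _⊓_; _≤′_; ≤′-refl; ≤′-step; z≤n; s≤s; _∸_; _≤?_; _<?_)
open import Data.Nat.Properties
  using (≤-trans; ≤-reflexive; n≤1+n; m≤n⇒m≤1+n; 1+n≰n; ≰⇒>; ≮⇒≥; +-suc;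
         +-monoˡ-≤; +-monoʳ-≤; +-identityʳ; +-assoc; m⊓n≤m; m⊓n≤n; ⊓-glb; ⊓-sel; ⊓-comm; z≤′n)
open import Data.Fin using (Fin; zero; suc; _≟_)
open import Data.Fin.Properties using (0≢1+n; suc-injective)
open import Data.Bool using (Bool; true; false; not; _∧_; _∨_; _xor_; if_then_else_)
open import Data.Bool.Properties using (∨-comm; ∨-zeroʳ; not-involutive; xor-comm; xor-same)
open import Data.Bool.ListAction using (any)
open import Data.List using ([]; _∷_; length; lookup; removeAt; allFin)
open import Data.List.Properties using (length-removeAt′)
open import Data.List.Membership.Propositional using (_∈_)
open import Data.List.Membership.Propositional.Properties using (∈-allFin)
open import Data.List.Relation.Unary.Any using (here; there)
open import Data.Product using (_×_; _,_; proj₁; proj₂; ∃-syntax)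
open import Data.Sum using (_⊎_; inj₁; inj₂)
open import Data.Empty using (⊥-elim)
open import Function using (_∘_)
open import Relation.Nullary using (¬_; yes; no)
open import Relation.Nullary.Decidable using (⌊_⌋)
open import Relation.Binary.PropositionalEquality

∨-true : ∀ a b → a ∨ b ≡ true → a ≡ true ⊎ b ≡ true
∨-true true  b h = inj₁ refl
∨-true false b h = inj₂ h

∧-true : ∀ a b → a ∧ b ≡ true → a ≡ true × b ≡ true
∧-true true b h = refl , h

∨-introʳ : ∀ a {b} → b ≡ true → a ∨ b ≡ true
∨-introʳ a refl = ∨-zeroʳ a

≟-sound : ∀ {M} (x y : Fin M) → ⌊ x ≟ y ⌋ ≡ true → x ≡ y
≟-sound x y h with x ≟ y
... | yes x≡y = x≡y

≟-refl : ∀ {M} (x : Fin M) → ⌊ x ≟ x ⌋ ≡ true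
≟-refl x with x ≟ x
... | yes _  = refl
... | no x≢x = ⊥-elim (x≢x refl)

≟-distinct : ∀ {M} (x y : Fin M) → x ≢ y → ⌊ x ≟ y ⌋ ≡ false
≟-distinct x y x≢y with x ≟ y
... | yes x≡y = ⊥-elim (x≢y x≡y)
... | no _    = refl

_⊆_ : ∀ {X : Set} → (X → Bool) → (X → Bool) → Set
f ⊆ g = ∀ x → f x ≡ true → g x ≡ true

count : ∀ {M} → (Fin M → Bool) → ℕ
count {zero}  f = 0
count {suc M} f = (if f zero then 1 else 0) + count (f ∘ suc)

count-≤ : ∀ {M} (f : Fin M → Bool) → count f ≤ M
count-≤ {zero}  f = z≤n
count-≤ {suc M} f with f zero
... | true  = s≤s (count-≤ (f ∘ suc))
... | false = m≤n⇒m≤1+n (count-≤ (f ∘ suc))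

count-full : ∀ {M} (f : Fin M → Bool) → (∀ x → f x ≡ true) → count f ≡ M
count-full {zero}  f h = refl
count-full {suc M} f h rewrite h zero = cong suc (count-full (f ∘ suc) (h ∘ suc))

count-empty : ∀ {M} (f : Fin M → Bool) → (∀ x → f x ≢ true) → count f ≡ 0
count-empty {zero}  f h = refl
count-empty {suc M} f h with f zero in e
... | true  = ⊥-elim (h zero e)
... | false = count-empty (f ∘ suc) (h ∘ suc)

count-≤1 : ∀ {M} (f : Fin M → Bool) (a : Fin M) → (∀ x → f x ≡ true → x ≡ a) → count f ≤ 1
count-≤1 {suc M} f zero h with f zero | count-empty (f ∘ suc) (λ x fx → 0≢1+n (sym (h (suc x) fx)))
... | true  | rest-empty = ≤-reflexive (cong suc rest-empty)
... | false | rest-empty = ≤-trans (≤-reflexive rest-empty) z≤n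
count-≤1 {suc M} f (suc a) h with f zero in e
... | true  = ⊥-elim (0≢1+n (h zero e))
... | false = count-≤1 (f ∘ suc) a (λ x fx → suc-injective (h (suc x) fx))

count-mono : ∀ {M} (f g : Fin M → Bool) → f ⊆ g → count f ≤ count g
count-mono {zero}  f g f⊆g = z≤n
count-mono {suc M} f g f⊆g with f zero in ef | g zero in eg
... | true  | true  = s≤s (count-mono (f ∘ suc) (g ∘ suc) (f⊆g ∘ suc))
... | true  | false with () ← trans (sym (f⊆g zero ef)) eg
... | false | true  = m≤n⇒m≤1+n (count-mono (f ∘ suc) (g ∘ suc) (f⊆g ∘ suc))
... | false | false = count-mono (f ∘ suc) (g ∘ suc) (f⊆g ∘ suc)

⊆-by-count : ∀ {M} (f g : Fin M → Bool) → f ⊆ g → count g ≤ count f → g ⊆ f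
⊆-by-count {suc M} f g f⊆g le x gx with f zero in ef | g zero in eg
⊆-by-count {suc M} f g f⊆g le zero gx | true | _ = ef
⊆-by-count {suc M} f g f⊆g (s≤s le) (suc x) gx | true | true =
  ⊆-by-count (f ∘ suc) (g ∘ suc) (f⊆g ∘ suc) le x gx
⊆-by-count {suc M} f g f⊆g le x gx | true | false with () ← trans (sym (f⊆g zero ef)) eg
⊆-by-count {suc M} f g f⊆g le x gx | false | true =
  ⊥-elim (1+n≰n (≤-trans le (count-mono (f ∘ suc) (g ∘ suc) (f⊆g ∘ suc))))
⊆-by-count {suc M} f g f⊆g le zero gx | false | false with () ← trans (sym gx) eg
⊆-by-count {suc M} f g f⊆g le (suc x) gx | false | false =
  ⊆-by-count (f ∘ suc) (g ∘ suc) (f⊆g ∘ suc) le x gx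

count-∨ : ∀ {M} (f g : Fin M → Bool) → count (λ x → f x ∨ g x) ≤ count f + count g
count-∨ {zero}  f g = z≤n
count-∨ {suc M} f g with f zero | g zero | count-∨ (f ∘ suc) (g ∘ suc)
... | true  | true  | ih = s≤s (≤-trans ih (+-monoʳ-≤ (count (f ∘ suc)) (n≤1+n _)))
... | true  | false | ih = s≤s ih
... | false | true  | ih = ≤-trans (s≤s ih) (≤-reflexive (sym (+-suc _ _)))
... | false | false | ih = ih

-- An increasing chain S 0 ⊆ S 1 ⊆ … of subsets of Fin M, in which one
-- stationary step makes the next step stationary, is stationary from step M
-- on: otherwise it would grow M + 1 times inside a set of M elements.
module Stabilise {M} (S : ℕ → Fin M → Bool)
                 (increasing : ∀ k → S k ⊆ S (suc k))
                 (persistent : ∀ k → S (suc k) ⊆ S k → S (suc (suc k)) ⊆ S (suc k)) where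

  Stationary : ℕ → Set
  Stationary k = S (suc k) ⊆ S k

  increasing-from : ∀ {j k} → j ≤′ k → S j ⊆ S k
  increasing-from ≤′-refl       x h = h
  increasing-from (≤′-step j≤k) x h = increasing _ x (increasing-from j≤k x h)

  stationary-from : ∀ {j k} → j ≤′ k → Stationary j → Stationary k
  stationary-from ≤′-refl       s = s
  stationary-from (≤′-step j≤k) s = persistent _ (stationary-from j≤k s)

  -- Equal counts of a subset and a superset force equality.
  stationary-or-grows : ∀ k → Stationary k ⊎ suc (count (S k)) ≤ count (S (suc k))
  stationary-or-grows k with count (S (suc k)) ≤? count (S k)
  ... | yes le = inj₁ (⊆-by-count (S k) (S (suc k)) (increasing k) le)
  ... | no  gt = inj₂ (≰⇒> gt)

  growth : ∀ k → (∃[ j ] (j ≤′ k × Stationary j)) ⊎ suc k ≤ count (S (suc k))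
  growth zero with stationary-or-grows zero
  ... | inj₁ s  = inj₁ (zero , ≤′-refl , s)
  ... | inj₂ gt = inj₂ (≤-trans (s≤s z≤n) gt)
  growth (suc k) with growth k | stationary-or-grows (suc k)
  ... | inj₁ (j , j≤k , s) | _       = inj₁ (j , ≤′-step j≤k , s)
  ... | inj₂ _             | inj₁ s  = inj₁ (suc k , ≤′-refl , s)
  ... | inj₂ big           | inj₂ gt = inj₂ (≤-trans (s≤s big) gt)

  stationary-at-M : Stationary M
  stationary-at-M with growth M
  ... | inj₁ (j , j≤M , s) = stationary-from j≤M s
  ... | inj₂ big           = ⊥-elim (1+n≰n (≤-trans big (count-≤ (S (suc M)))))

any-witness : ∀ {X : Set} (p : X → Bool) xs → any p xs ≡ true → ∃[ x ] p x ≡ true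
any-witness p (x ∷ xs) h with p x in e
... | true  = x , e
... | false = any-witness p xs h

any-∈ : ∀ {X : Set} (p : X → Bool) {x xs} → x ∈ xs → p x ≡ true → any p xs ≡ true
any-∈ p (here refl) h rewrite h = refl
any-∈ p {xs = y ∷ ys} (there x∈ys) h = ∨-introʳ (p y) (any-∈ p x∈ys h)

any-mono : ∀ {X : Set} (p q : X → Bool) → p ⊆ q → ∀ xs → any p xs ≡ true → any q xs ≡ true
any-mono p q p⊆q (x ∷ xs) h with p x in e
... | true rewrite p⊆q x e = refl
... | false = ∨-introʳ (q x) (any-mono p q p⊆q xs h)

any-removeAt : ∀ {X : Set} (p : X → Bool) xs k → any p xs ≡ true →
               p (lookup xs k) ≡ true ⊎ any p (removeAt xs k) ≡ true
any-removeAt p (x ∷ xs) zero h = ∨-true (p x) _ h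
any-removeAt p (x ∷ xs) (suc k) h with ∨-true (p x) (any p xs) h
... | inj₁ px = inj₂ (cong (_∨ any p (removeAt xs k)) px)
... | inj₂ rest with any-removeAt p xs k rest
...   | inj₁ removed = inj₁ removed
...   | inj₂ kept    = inj₂ (∨-introʳ (p x) kept)

-- The edge e joins x and y; `adjB E x y` is `any (joins x y) E`.
joins : ∀ {M} → Fin M → Fin M → Fin M × Fin M → Bool
joins x y e = (⌊ proj₁ e ≟ x ⌋ ∧ ⌊ proj₂ e ≟ y ⌋) ∨ (⌊ proj₁ e ≟ y ⌋ ∧ ⌊ proj₂ e ≟ x ⌋)

adjB-sym : ∀ {M} (E : Graph M) x y → adjB E x y ≡ adjB E y x
adjB-sym []      x y = refl
adjB-sym (e ∷ E) x y =
  cong₂ _∨_ (∨-comm (⌊ proj₁ e ≟ x ⌋ ∧ ⌊ proj₂ e ≟ y ⌋) (⌊ proj₁ e ≟ y ⌋ ∧ ⌊ proj₂ e ≟ x ⌋))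
            (adjB-sym E x y)

data Reach {M} (E : Graph M) (x : Fin M) : Fin M → Set where
  here : Reach E x x
  step : ∀ {y z} → Reach E x y → adjB E y z ≡ true → Reach E x z

reach-trans : ∀ {M} {E : Graph M} {x y z} → Reach E x y → Reach E y z → Reach E x z
reach-trans r here       = r
reach-trans r (step s a) = step (reach-trans r s) a

reach-sym : ∀ {M} {E : Graph M} {x y} → Reach E x y → Reach E y x
reach-sym here = here
reach-sym {E = E} (step {y} {z} r a) =
  reach-trans (step here (trans (adjB-sym E z y) a)) (reach-sym r)

stepB-mono : ∀ {M} (E : Graph M) (R R' : Fin M → Bool) → R ⊆ R' → stepB E R ⊆ stepB E R'
stepB-mono {M} E R R' R⊆R' y h with R y in e
... | true rewrite R⊆R' y e = refl
... | false = ∨-introʳ (R' y) (any-mono _ _ inner (allFin M) h)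
  where
  inner : (λ z → R z ∧ adjB E z y) ⊆ (λ z → R' z ∧ adjB E z y)
  inner z hz with ∧-true (R z) _ hz
  ... | Rz , a rewrite R⊆R' z Rz = a

-- `comp E x` is exactly the set of vertices reachable from x: the k-th
-- iterate contains only reachable vertices, and the iteration is
-- stationary by step M, so the M-th iterate is closed under adjacency.
module Closure {M} (E : Graph M) (x : Fin M) where

  S : ℕ → Fin M → Bool
  S k = iterB E k (λ y → ⌊ y ≟ x ⌋)

  sound : ∀ k y → S k y ≡ true → Reach E x y
  sound zero y h with ≟-sound y x h
  ... | refl = here
  sound (suc k) y h with S k y in e
  ... | true  = sound k y e
  ... | false with any-witness _ (allFin M) h
  ...   | z , hz with ∧-true (S k z) _ hz
  ...     | Sz , a = step (sound k z Sz) a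

  increasing : ∀ k → S k ⊆ S (suc k)
  increasing k y h rewrite h = refl

  open Stabilise S increasing (λ k → stepB-mono E (S (suc k)) (S k))

  closed : ∀ {y z} → S M y ≡ true → adjB E y z ≡ true → S M z ≡ true
  closed {y} {z} Sy a = stationary-at-M z
    (∨-introʳ (S M z) (any-∈ (λ w → S M w ∧ adjB E w z) (∈-allFin y) (trans (cong (_∧ _) Sy) a)))

  complete : ∀ {y} → Reach E x y → S M y ≡ true
  complete here       = increasing-from {k = M} z≤′n x (≟-refl x)
  complete (step r a) = closed (complete r) a

comp-sound : ∀ {M} (E : Graph M) x y → comp E x y ≡ true → Reach E x y
comp-sound {M} E x = Closure.sound E x M

comp-complete : ∀ {M} (E : Graph M) x y → Reach E x y → comp E x y ≡ true
comp-complete E x y = Closure.complete E x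

-- Processing the edges one by one, a
-- union-find style labelling `rep E` sends every vertex to a representative
-- of its component; vertices that are their own representative ("roots")
-- lose at most one per edge, so M ≤ roots + #edges, and a connected graph
-- has a single root.

redirect : ∀ {M} (a b t : Fin M) → Fin M
redirect a b t with t ≟ a
... | yes _ = b
... | no  _ = t

redirect-hit : ∀ {M} (a b t : Fin M) → t ≡ a → redirect a b t ≡ b
redirect-hit a b t t≡a with t ≟ a
... | yes _  = refl
... | no t≢a = ⊥-elim (t≢a t≡a)

redirect-miss : ∀ {M} (a b t : Fin M) → t ≢ a → redirect a b t ≡ t
redirect-miss a b t t≢a with t ≟ a
... | yes t≡a = ⊥-elim (t≢a t≡a)
... | no _    = refl

redirect-target : ∀ {M} (a b : Fin M) → redirect a b b ≡ b
redirect-target a b with b ≟ a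
... | yes _ = refl
... | no  _ = refl

-- The representative after merging, edge by edge from the end of the list,
-- the class of u into the class of v.
rep : ∀ {M} → Graph M → Fin M → Fin M
rep []            y = y
rep ((u , v) ∷ E) y = redirect (rep E u) (rep E v) (rep E y)

adjB-rep : ∀ {M} (E : Graph M) x y → adjB E x y ≡ true → rep E x ≡ rep E y
adjB-rep ((u , v) ∷ E) x y h with ∨-true _ _ h
... | inj₂ rest = cong (redirect (rep E u) (rep E v)) (adjB-rep E x y rest)
... | inj₁ new with ∨-true _ _ new
...   | inj₁ uv with ∧-true ⌊ u ≟ x ⌋ _ uv
...     | ux , vy with ≟-sound u x ux | ≟-sound v y vy
...       | refl | refl = trans (redirect-hit (rep E u) (rep E v) (rep E u) refl)
                                (sym (redirect-target (rep E u) (rep E v)))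
adjB-rep ((u , v) ∷ E) x y h | inj₁ new | inj₂ vu with ∧-true ⌊ u ≟ y ⌋ _ vu
...     | uy , vx with ≟-sound u y uy | ≟-sound v x vx
...       | refl | refl = trans (redirect-target (rep E u) (rep E v))
                                (sym (redirect-hit (rep E u) (rep E v) (rep E u) refl))

reach-rep : ∀ {M} {E : Graph M} {x y} → Reach E x y → rep E x ≡ rep E y
reach-rep here = refl
reach-rep {E = E} (step {y} {z} r a) = trans (reach-rep r) (adjB-rep E y z a)

IsRoot : ∀ {M} → Graph M → Fin M → Bool
IsRoot E x = ⌊ rep E x ≟ x ⌋

roots : ∀ {M} → Graph M → ℕ
roots E = count (IsRoot E)

-- Adding the edge uv can only un-root the representative of u.
roots-cons : ∀ {M} (u v : Fin M) (E : Graph M) → roots E ≤ roots ((u , v) ∷ E) + 1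
roots-cons {M} u v E =
  ≤-trans (count-mono (IsRoot E) (λ x → IsRoot E' x ∨ old x) still-root)
    (≤-trans (count-∨ (IsRoot E') old)
      (+-monoʳ-≤ (roots E') (count-≤1 old (rep E u) (λ x h → ≟-sound x (rep E u) h))))
  where
  E' : Graph M
  E' = (u , v) ∷ E
  old : Fin M → Bool
  old x = ⌊ x ≟ rep E u ⌋
  still-root : IsRoot E ⊆ (λ x → IsRoot E' x ∨ old x)
  still-root x root with x ≟ rep E u
  ... | yes _  = ∨-zeroʳ (IsRoot E' x)
  ... | no x≢r = cong (_∨ false) root'
    where
    root' : IsRoot E' x ≡ true
    root' rewrite ≟-sound (rep E x) x root | redirect-miss (rep E u) (rep E v) x x≢r = ≟-refl x

roots-length : ∀ {M} (E : Graph M) → M ≤ roots E + length E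
roots-length {M} []       = ≤-reflexive (sym (trans (+-identityʳ (roots {M} [])) (count-full _ ≟-refl)))
roots-length ((u , v) ∷ E) =
  ≤-trans (roots-length E) (≤-trans (+-monoˡ-≤ (length E) (roots-cons u v E))
    (≤-reflexive (+-assoc (roots ((u , v) ∷ E)) 1 (length E))))

connected-length : ∀ {M} (E : Graph M) x₀ → (∀ y → Reach E x₀ y) → M ≤ 1 + length E
connected-length E x₀ connected =
  ≤-trans (roots-length E) (+-monoˡ-≤ (length E) (count-≤1 (IsRoot E) (rep E x₀) single))
  where
  single : ∀ x → IsRoot E x ≡ true → x ≡ rep E x₀
  single x root = trans (sym (≟-sound (rep E x) x root)) (sym (reach-rep (connected x)))

-- Deleting the i-th edge PQ of the tree T leaves a forest in which every
-- block is reachable from exactly one of P and Q: from at least one because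
-- T is connected, from at most one because otherwise the forest would be a
-- connected graph on m blocks with only m - 2 edges.
module EdgeDeletion {n} (T : BlockTree n) (i : Fin (length (ET T))) (P Q : Fin (m T))
                    (edge : lookup (ET T) i ≡ (P , Q)) where

  forest : Graph (m T)
  forest = removeAt (ET T) i

  split-walk : ∀ {y} → Reach (ET T) P y → Reach forest P y ⊎ Reach forest Q y
  split-walk here = inj₁ here
  split-walk (step {y} {z} r a) with any-removeAt (joins y z) (ET T) i a
  ... | inj₂ kept with split-walk r
  ...   | inj₁ r' = inj₁ (step r' kept)
  ...   | inj₂ r' = inj₂ (step r' kept)
  split-walk (step {y} {z} r a) | inj₁ removed
    with ∨-true _ _ (subst (λ e → joins y z e ≡ true) edge removed)
  ... | inj₁ forward with ≟-sound Q z (proj₂ (∧-true ⌊ P ≟ y ⌋ _ forward))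
  ...   | refl = inj₂ here
  split-walk (step {y} {z} r a) | inj₁ removed | inj₂ backward
    with ≟-sound P z (proj₁ (∧-true _ _ backward))
  ...   | refl = inj₁ here

  either-side : ∀ y → Reach forest P y ⊎ Reach forest Q y
  either-side y = split-walk (comp-sound (ET T) P y (proj₁ (proj₂ (tree T)) P y))

  sides-disconnected : ¬ Reach forest P Q
  sides-disconnected P~Q = too-few-edges (m T) (proj₁ (tree T))
    (≤-trans (connected-length forest P connected)
      (≤-reflexive (trans (sym (length-removeAt′ (ET T) i)) (proj₂ (proj₂ (tree T))))))
    where
    connected : ∀ y → Reach forest P y
    connected y with either-side y
    ... | inj₁ r = r
    ... | inj₂ r = reach-trans P~Q r
    too-few-edges : ∀ k → 1 ≤ k → ¬ (k ≤ k ∸ 1)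
    too-few-edges (suc k) _ = 1+n≰n

  endpoints-distinct : P ≢ Q
  endpoints-distinct refl = sides-disconnected here

  sides-complementary : ∀ y → comp forest P y ≡ not (comp forest Q y)
  sides-complementary y with comp forest P y in eP | comp forest Q y in eQ
  ... | true  | false = refl
  ... | false | true  = refl
  ... | true  | true  = ⊥-elim (sides-disconnected
        (reach-trans (comp-sound forest P y eP) (reach-sym (comp-sound forest Q y eQ))))
  ... | false | false with either-side y
  ...   | inj₁ r with () ← trans (sym (comp-complete forest P y r)) eP
  ...   | inj₂ r with () ← trans (sym (comp-complete forest Q y r)) eQ

d-complement : ∀ {n} (G : Graph n) (X : VSet n) → d G (not ∘ X) ≡ d G X
d-complement []            X = refl
d-complement ((u , v) ∷ G) X = cong₂ _+_ (cong (λ b → if b then 1 else 0) (not-xor-not (X u) (X v)))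
                                         (d-complement G X)
  where
  not-xor-not : ∀ p q → (not p xor not q) ≡ (p xor q)
  not-xor-not true  q = refl
  not-xor-not false q = not-involutive q

d-ext : ∀ {n} (G : Graph n) (X Y : VSet n) → (∀ v → X v ≡ Y v) → d G X ≡ d G Y
d-ext []            X Y X≗Y = refl
d-ext ((u , v) ∷ G) X Y X≗Y rewrite X≗Y u | X≗Y v = cong (_ +_) (d-ext G X Y X≗Y)

c-swap : ∀ {n} (G : Graph n) (T : BlockTree n) i P Q → lookup (ET T) i ≡ (P , Q) →
         c G T i Q ≡ c G T i P
c-swap G T i P Q edge = trans (sym (d-complement G (C T i Q)))
  (d-ext G _ _ (λ v → sym (EdgeDeletion.sides-complementary T i P Q edge (blk T v))))

separates-sym : ∀ {n} (X : VSet n) v w → Separates X v w → Separates X w v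
separates-sym X v w s = trans (xor-comm (X w) (X v)) s

separates-irrefl : ∀ {n} (X : VSet n) v → ¬ Separates X v v
separates-irrefl X v s with () ← trans (sym (xor-same (X v))) s

singleton-separates : ∀ {n} (v w : Fin n) → v ≢ w → Separates (singleton v) v w
singleton-separates v w v≢w rewrite ≟-refl v | ≟-distinct w v (v≢w ∘ sym) = refl

separates-chain : ∀ {n} (X : VSet n) a a' b' b → Separates X a b →
                  Separates X a a' ⊎ Separates X a' b' ⊎ Separates X b' b
separates-chain X a a' b' b = chain (X a) (X a') (X b') (X b)
  where
  chain : ∀ p q r s → (p xor s) ≡ true →
          (p xor q) ≡ true ⊎ (q xor r) ≡ true ⊎ (r xor s) ≡ true
  chain false false false s h = inj₂ (inj₂ h)
  chain true  true  true  s h = inj₂ (inj₂ h)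
  chain false false true  s h = inj₂ (inj₁ refl)
  chain true  true  false s h = inj₂ (inj₁ refl)
  chain false true  r     s h = inj₁ refl
  chain true  false r     s h = inj₁ refl

module Connectivity {n} (G : Graph n) where

  λ-sym : ∀ {v w k} → IsLambda G v w k → IsLambda G w v k
  λ-sym {v} {w} ((X , s , dX) , least) =
    (X , separates-sym X v w s , dX) , (λ Y s' → least Y (separates-sym Y w v s'))

  λ-distinct : ∀ {v w k} → IsLambda G v w k → v ≢ w
  λ-distinct {v} ((X , s , _) , _) refl = separates-irrefl X v s

  λ-≤-deg : ∀ {v w k} → IsLambda G v w k → k ≤ deg G v
  λ-≤-deg {v} {w} L = proj₂ L (singleton v) (singleton-separates v w (λ-distinct L))

  pendant-sym : ∀ {v w} → Pendant G v w → Pendant G w v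
  pendant-sym {v} {w} p = subst (IsLambda G w v) (⊓-comm (deg G v) (deg G w)) (λ-sym p)

  -- Since the smaller of the two singletons attains min{d(v), d(w)}, this
  -- lower bound on separating cuts is all a pair needs to be pendant.
  pendant-from-bound : ∀ {v w} → v ≢ w →
    (∀ X → Separates X v w → deg G v ⊓ deg G w ≤ d G X) → Pendant G v w
  pendant-from-bound {v} {w} v≢w bound = attained (⊓-sel (deg G v) (deg G w)) , bound
    where
    attained : deg G v ⊓ deg G w ≡ deg G v ⊎ deg G v ⊓ deg G w ≡ deg G w →
               ∃[ X ] (Separates X v w × d G X ≡ deg G v ⊓ deg G w)
    attained (inj₁ e) = singleton v , singleton-separates v w v≢w , sym e
    attained (inj₂ e) = singleton w ,
      separates-sym (singleton w) w v (singleton-separates w v (v≢w ∘ sym)) , sym e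

  linked-bound : ∀ {v w} → v ≡ w ⊎ Pendant G v w →
    ∀ X → Separates X v w → deg G v ⊓ deg G w ≤ d G X
  linked-bound {v} (inj₁ refl) X s = ⊥-elim (separates-irrefl X v s)
  linked-bound     (inj₂ p)    X s = proj₂ p X s

  pendant-through : ∀ {a a' b' b k} → a ≢ b →
    a ≡ a' ⊎ Pendant G a a' → b' ≡ b ⊎ Pendant G b' b →
    IsLambda G a' b' k → deg G a ⊓ deg G b ≤ k → Pendant G a b
  pendant-through {a} {a'} {b'} {b} {k} a≢b aa' b'b L t≤k = pendant-from-bound a≢b bound
    where
    bound : ∀ X → Separates X a b → deg G a ⊓ deg G b ≤ d G X
    bound X s with separates-chain X a a' b' b s
    ... | inj₁ s₁ = ≤-trans (⊓-glb (m⊓n≤m _ _) (≤-trans t≤k (λ-≤-deg L))) (linked-bound aa' X s₁)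
    ... | inj₂ (inj₁ s₂) = ≤-trans t≤k (proj₂ L X s₂)
    ... | inj₂ (inj₂ s₃) =
      ≤-trans (⊓-glb (≤-trans t≤k (λ-≤-deg (λ-sym L))) (m⊓n≤n _ _)) (linked-bound b'b X s₃)

open Connectivity

-- The data an edge AB of a pendant tree provides, oriented from A to B:
-- A ≠ B, a non-pendant pair across the edge (property (ii)), and a pair
-- across it whose λ equals c(AB) computed from the A side (property (iii)).
record EdgeWitnesses {n} (G : Graph n) (T : BlockTree n)
                     (i : Fin (length (ET T))) (A B : Fin (m T)) : Set where
  field
    distinct    : A ≢ B
    a b         : Fin n
    a∈A         : blk T a ≡ A
    b∈B         : blk T b ≡ B
    non-pendant : ¬ Pendant G a b
    a* b*       : Fin n
    a*∈A        : blk T a* ≡ A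
    b*∈B        : blk T b* ≡ B
    cut-is-λ    : IsLambda G a* b* (c G T i A)

module _ {n} (G : Graph n) (T : BlockTree n) (i : Fin (length (ET T))) where

  witnesses : IsPendantTree G T → ∀ {A B} → lookup (ET T) i ≡ (A , B) →
              EdgeWitnesses G T i A B
  witnesses (_ , non-pendant , cut) {A} {B} edge with non-pendant i | cut i
  ... | a , b , ha , hb , np | a* , b* , ha* , hb* , L = record
    { distinct = EdgeDeletion.endpoints-distinct T i A B edge
    ; a = a ; b = b ; a∈A = trans ha first ; b∈B = trans hb second ; non-pendant = np
    ; a* = a* ; b* = b* ; a*∈A = trans ha* first ; b*∈B = trans hb* second
    ; cut-is-λ = subst (λ Z → IsLambda G a* b* (c G T i Z)) first L }
    where
    first : eA T i ≡ A
    first = cong proj₁ edge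
    second : eB T i ≡ B
    second = cong proj₂ edge

  -- Reversing the orientation uses c(AB) = c(BA) and the symmetry of λ.
  witnesses-swap : ∀ {A B} → lookup (ET T) i ≡ (A , B) →
                   EdgeWitnesses G T i A B → EdgeWitnesses G T i B A
  witnesses-swap {A} {B} edge ws = record
    { distinct = distinct ∘ sym
    ; a = b ; b = a ; a∈A = b∈B ; b∈B = a∈A ; non-pendant = non-pendant ∘ pendant-sym G
    ; a* = b* ; b* = a* ; a*∈A = b*∈B ; b*∈B = a*∈A
    ; cut-is-λ = λ-sym G (subst (IsLambda G a* b*) (sym (c-swap G T i A B edge)) cut-is-λ) }
    where open EdgeWitnesses ws

  -- The heart of Lemma 8: if d(a_max) ≤ c(AB), the witnesses a, b would be
  -- pendant through the chain a, a*, b*, b.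
  cut-below-max-degree : (∀ v w → v ≢ w → blk T v ≡ blk T w → Pendant G v w) →
    ∀ {A B} → EdgeWitnesses G T i A B →
    (amax : Fin n) → (∀ v → blk T v ≡ A → deg G v ≤ deg G amax) → c G T i A < deg G amax
  cut-below-max-degree within {A} ws amax maximal with c G T i A <? deg G amax
  ... | yes below = below
  ... | no  above =
    ⊥-elim (non-pendant (pendant-through G a≢b (linked a∈A a*∈A) (linked b*∈B b∈B) cut-is-λ t≤c))
    where
    open EdgeWitnesses ws
    t≤c : deg G a ⊓ deg G b ≤ c G T i A
    t≤c = ≤-trans (m⊓n≤m _ _) (≤-trans (maximal a a∈A) (≮⇒≥ above))
    a≢b : a ≢ b
    a≢b refl = distinct (trans (sym a∈A) b∈B)
    -- By property (i), two vertices of one block are equal or pendant.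
    linked : ∀ {u v X} → blk T u ≡ X → blk T v ≡ X → u ≡ v ⊎ Pendant G u v
    linked {u} {v} u∈X v∈X with u ≟ v
    ... | yes u≡v = inj₁ u≡v
    ... | no  u≢v = inj₂ (within u v u≢v (trans u∈X (sym v∈X)))

lemma8 : ∀ {n} (G : Graph n) (T : BlockTree n) → IsPendantTree G T →
         (i : Fin (length (ET T))) (A B : Fin (m T)) →
         (lookup (ET T) i ≡ (A , B) ⊎ lookup (ET T) i ≡ (B , A)) →
         (amax : Fin n) → blk T amax ≡ A →
         (∀ v → blk T v ≡ A → deg G v ≤ deg G amax) →
         c G T i A < deg G amax
lemma8 G T pendant-tree i A B (inj₁ edge) amax _ maximal =
  cut-below-max-degree G T i (proj₁ pendant-tree) (witnesses G T i pendant-tree edge) amax maximal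
lemma8 G T pendant-tree i A B (inj₂ edge) amax _ maximal =
  cut-below-max-degree G T i (proj₁ pendant-tree)
    (witnesses-swap G T i edge (witnesses G T i pendant-tree edge)) amax maximal
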